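{- (i) There exists a semigroup $(M,*)$ with $*$ non-commutative which is abstractable. (ii) There exists a semigroup $(M,*)$ with $*$ non-commutative which is not abstractable. (iii) There exists a magma $(M,*)$ with $*$ non-associative which is abstractable.
   Context: A magma $(M,*)$ is a set with a binary operation $*:M\times M\to M$; a semigroup is a magma with associative operation. The magma is called abstractable if $(a*b)*(c*d)=(a*c)*(b*d)$ for all $a,b,c,d\in M$. -}

module Defs where

open import Algebra.Bundles using (Magma; Semigroup)
open import Algebra.Definitions using (Commutative; Associative)
open import Relation.Binary.Core using (Rel)
open import Relation.Nullary using (¬_)
open import Level using (_⊔_)

Abstractable : ∀ {a ℓ} {A : Set a} → Rel A ℓ → (A → A → A) → Set (a ⊔ ℓ)
Abstractable _≈_ _*_ = ∀ a b c d → ((a * b) * (c * d)) ≈ ((a * c) * (b * d))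

MagmaAbstractable : ∀ {c ℓ} → Magma c ℓ → Set (c ⊔ ℓ)
MagmaAbstractable M = Abstractable (Magma._≈_ M) (Magma._∙_ M)

SemigroupAbstractable : ∀ {c ℓ} → Semigroup c ℓ → Set (c ⊔ ℓ)
SemigroupAbstractable S = Abstractable (Semigroup._≈_ S) (Semigroup._∙_ S)

SemigroupNonCommutative : ∀ {c ℓ} → Semigroup c ℓ → Set (c ⊔ ℓ)
SemigroupNonCommutative S = ¬ Commutative (Semigroup._≈_ S) (Semigroup._∙_ S)

MagmaNonAssociative : ∀ {c ℓ} → Magma c ℓ → Set (c ⊔ ℓ)
MagmaNonAssociative M = ¬ Associative (Magma._≈_ M) (Magma._∙_ M)

-- A magma with x ∙ y = f x is always abstractable, since both sides of the
-- law evaluate to f (f a); it is associative only when f is idempotent. Taking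
-- f = id gives the left-zero semigroup (non-commutative on two points), and
-- taking f = not gives a non-associative abstractable magma on Bool. The free
-- semigroup of lists is not abstractable: [] ++ [x] ++ [y] ++ [] would have to
-- equal [] ++ [y] ++ [x] ++ [].
module Submission where

open import Defs
open import Algebra.Bundles using (Magma; Semigroup)
open import Algebra.Definitions using (Commutative; Associative)
open import Data.Bool using (Bool; true; false; not)
open import Data.List using ([]; [_]; _++_)
open import Data.List.Properties using (∷-injectiveˡ; ++-semigroup)
open import Data.Product using (Σ; _×_; _,_)
open import Function using (id)
open import Level using (Level; 0ℓ)
open import Relation.Binary.PropositionalEquality
  using (_≡_; _≢_; refl; cong; isEquivalence)
open import Relation.Nullary using (¬_)

private
  variable
    a : Level
    A : Set a

applyLeft : (A → A) → A → A → A
applyLeft f x _ = f x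

applyLeft-abstractable : (f : A → A) → Abstractable _≡_ (applyLeft f)
applyLeft-abstractable f _ _ _ _ = refl

applyLeft-assoc⇒idempotent : (f : A → A) → Associative _≡_ (applyLeft f) →
                              ∀ x → f (f x) ≡ f x
applyLeft-assoc⇒idempotent f assoc x = assoc x x x

applyLeft-magma : (A → A) → Magma _ _
applyLeft-magma {A = A} f = record
  { Carrier = A
  ; _≈_     = _≡_
  ; _∙_     = applyLeft f
  ; isMagma = record { isEquivalence = isEquivalence ; ∙-cong = λ p _ → cong f p }
  }

leftZero-semigroup : Set a → Semigroup a a
leftZero-semigroup A = record
  { Carrier     = A
  ; _≈_         = _≡_
  ; _∙_         = applyLeft id
  ; isSemigroup = record
    { isMagma = Magma.isMagma (applyLeft-magma {A = A} id)
    ; assoc   = λ _ _ _ → refl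
    }
  }

leftZero-noncommutative : {x y : A} → x ≢ y → ¬ Commutative _≡_ (applyLeft {A = A} id)
leftZero-noncommutative x≢y comm = x≢y (comm _ _)

++-noncommutative : {x y : A} → x ≢ y → ¬ Commutative _≡_ (_++_ {A = A})
++-noncommutative {x = x} {y} x≢y comm = x≢y (∷-injectiveˡ (comm [ x ] [ y ]))

++-not-abstractable : {x y : A} → x ≢ y → ¬ Abstractable _≡_ (_++_ {A = A})
++-not-abstractable {x = x} {y} x≢y abs = x≢y (∷-injectiveˡ (abs [] [ x ] [ y ] []))

true≢false : true ≢ false
true≢false ()

mainTheorem8 :
    (Σ (Semigroup 0ℓ 0ℓ) λ S → SemigroupNonCommutative S × SemigroupAbstractable S)
    × (Σ (Semigroup 0ℓ 0ℓ) λ S → SemigroupNonCommutative S × ¬ SemigroupAbstractable S)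
    × (Σ (Magma 0ℓ 0ℓ) λ M → MagmaNonAssociative M × MagmaAbstractable M)
mainTheorem8 =
    ( leftZero-semigroup Bool
    , leftZero-noncommutative true≢false
    , applyLeft-abstractable id )
  , ( ++-semigroup Bool
    , ++-noncommutative true≢false
    , ++-not-abstractable true≢false )
  , ( applyLeft-magma not
    , (λ assoc → true≢false (applyLeft-assoc⇒idempotent not assoc true))
    , applyLeft-abstractable not )
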